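{- Let $\mathrm{H}$ be the digraph with vertex set $\{0,1,2\}$ and edge set $\{(0,0),(2,2),(0,1),(1,0),(0,2),(2,0),(2,1)\}$. Then $\mathrm{H}$ admits a weak near-unanimity polymorphism.
   Context: A $k$-ary polymorphism of $\mathrm{H}$ is a map $f:V(\mathrm{H})^k\to V(\mathrm{H})$ such that whenever $(x_1,y_1),\dots,(x_k,y_k)\in E(\mathrm{H})$, also $(f(x_1,\dots,x_k),f(y_1,\dots,y_k))\in E(\mathrm{H})$. An operation $t:D^k\to D$ is a weak near-unanimity operation if $t(x,\dots,x)=x$ for all $x$ and $t(y,x,\dots,x)=t(x,y,x,\dots,x)=\dots=t(x,\dots,x,y)$ for all $x,y$. -}

module Defs where

open import Data.Nat using (ℕ; _≤_)
open import Data.Fin using (Fin; zero; suc; _≟_)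
open import Data.Product using (Σ; _×_; ∃)
open import Relation.Binary.PropositionalEquality using (_≡_)
open import Relation.Nullary using (yes; no)

Digraph : Set → Set₁
Digraph V = V → V → Set

V : Set
V = Fin 3

v0 v1 v2 : V
v0 = zero
v1 = suc zero
v2 = suc (suc zero)

data H : Digraph V where
  e00 : H v0 v0
  e22 : H v2 v2
  e01 : H v0 v1
  e10 : H v1 v0
  e02 : H v0 v2
  e20 : H v2 v0
  e21 : H v2 v1

Op : Set → ℕ → Set
Op D k = (Fin k → D) → D

IsPolymorphism : {D : Set} (E : Digraph D) (k : ℕ) → Op D k → Set
IsPolymorphism {D} E k f =
  (x y : Fin k → D) → ((i : Fin k) → E (x i) (y i)) → E (f x) (f y)

oneAt : {D : Set} {k : ℕ} → Fin k → D → D → Fin k → D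
oneAt i x y j with i ≟ j
... | yes _ = y
... | no _ = x

IsWNU : {D : Set} (k : ℕ) → Op D k → Set
IsWNU {D} k t =
  ((x : D) → t (λ _ → x) ≡ x) ×
  ((x y : D) (i j : Fin k) → t (oneAt i x y) ≡ t (oneAt j x y))

-- Vertex 0 of H is joined to and from every vertex.  Hence the binary operation
-- sending (x, x) to x and everything else to 0 is a polymorphism: for edges
-- a → b and c → d, either both coordinate pairs agree and the image is the edge
-- a → b, or one of them disagrees and the image is an edge into or out of 0.
-- It is idempotent and commutative, hence a binary weak near-unanimity operation.
module Submission where

open import Defs
open import Algebra.Definitions using (Commutative; Idempotent)
open import Data.Nat using (ℕ; _≤_; s≤s; z≤n)
open import Data.Product using (Σ; _×_; _,_)
open import Data.Fin using (Fin; zero; suc)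
import Data.Fin.Properties as Fin
open import Relation.Binary.Definitions using (DecidableEquality)
open import Relation.Binary.PropositionalEquality using (_≡_; refl; sym)
open import Relation.Nullary using (yes; no; contradiction)

binary : {D : Set} → (D → D → D) → Op D 2
binary f x = f (x zero) (x (suc zero))

binary-isPolymorphism : {D : Set} (E : Digraph D) {f : D → D → D} →
  (∀ {a b c d} → E a b → E c d → E (f a c) (f b d)) →
  IsPolymorphism E 2 (binary f)
binary-isPolymorphism E preserves x y edge = preserves (edge zero) (edge (suc zero))

binary-isWNU : {D : Set} {f : D → D → D} →
  Idempotent _≡_ f → Commutative _≡_ f → IsWNU 2 (binary f)
binary-isWNU {f = f} idem comm = idem , swap
  where
  swap : ∀ x y (i j : Fin 2) → binary f (oneAt i x y) ≡ binary f (oneAt j x y)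
  swap x y zero       zero       = refl
  swap x y zero       (suc zero) = comm y x
  swap x y (suc zero) zero       = comm x y
  swap x y (suc zero) (suc zero) = refl

module Agreement {D : Set} (_≟_ : DecidableEquality D) (z : D) where

  agree : D → D → D
  agree x y with x ≟ y
  ... | yes _ = x
  ... | no  _ = z

  agree-idem : Idempotent _≡_ agree
  agree-idem x with x ≟ x
  ... | yes _   = refl
  ... | no  x≢x = contradiction refl x≢x

  agree-comm : Commutative _≡_ agree
  agree-comm x y with x ≟ y | y ≟ x
  ... | yes refl | yes _   = refl
  ... | yes x≡y  | no  y≢x = contradiction (sym x≡y) y≢x
  ... | no  x≢y  | yes y≡x = contradiction (sym y≡x) x≢y
  ... | no  _    | no  _   = refl

  agree-preserves : (E : Digraph D) → (∀ y → E z y) → (∀ x → E x z) →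
    ∀ {a b c d} → E a b → E c d → E (agree a c) (agree b d)
  agree-preserves E from-z to-z {a} {b} {c} {d} ab cd with a ≟ c | b ≟ d
  ... | yes refl | yes refl = ab
  ... | yes _    | no  _    = to-z a
  ... | no  _    | yes _    = from-z b
  ... | no  _    | no  _    = from-z z

H-from-v0 : ∀ y → H v0 y
H-from-v0 zero             = e00
H-from-v0 (suc zero)       = e01
H-from-v0 (suc (suc zero)) = e02

H-to-v0 : ∀ x → H x v0
H-to-v0 zero             = e00
H-to-v0 (suc zero)       = e10
H-to-v0 (suc (suc zero)) = e20

open Agreement Fin._≟_ v0

lemma29 : Σ ℕ (λ k → (2 ≤ k) × Σ (Op V k) (λ t → IsPolymorphism H k t × IsWNU k t))
lemma29 =
  2 , s≤s (s≤s z≤n) , binary agree ,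
  binary-isPolymorphism H (agree-preserves H H-from-v0 H-to-v0) ,
  binary-isWNU agree-idem agree-comm
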